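{- Let $G(V,E)$ be a graph and let $w$ be a permutational $1$-$11$-representation of $G$, written as a concatenation of permutations of $V$. If $w$ contains a cube $P_iP_iP_i$ where $P_i$ is one of the permutations in this concatenation (i.e. three consecutive permutations in the concatenation are equal to $P_i$), then the word obtained from $w$ by deleting two of these three occurrences of $P_i$ is also a $1$-$11$-representation of $G$.
   Context: For a word $w$ and letters $x,y$, $w_{\{x,y\}}$ denotes the word obtained from $w$ by deleting all letters other than $x$ and $y$. A word $w\in V^{+}$ is a $1$-$11$-representation of a graph $G(V,E)$ if for all distinct $x,y\in V$: $x,y$ are adjacent in $G$ iff $w_{\{x,y\}}$ contains at most one factor of the form $xx$ or $yy$ in total (equivalently, non-adjacent iff $w_{\{x,y\}}$ contains at least two occurrences of $xx$, or at least two of $yy$, or at least one of each). A $1$-$11$-representation is permutational if it is a concatenation of permutations of $V$ (words in which each vertex of $V$ occurs exactly once). -}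

module Defs where

open import Data.Nat using (ℕ; zero; suc; _+_; _≤_)
open import Data.Fin using (Fin; _≟_)
open import Data.List using (List; []; _∷_; filter; allFin; concat; _++_)
open import Data.List.Relation.Unary.All using (All)
open import Data.List.Relation.Binary.Permutation.Propositional using (_↭_)
open import Data.Product using (_×_)
open import Data.Sum using (_⊎_)
open import Relation.Nullary using (¬_; Dec; yes; no; does)
open import Data.Bool using (if_then_else_; _∧_)
open import Relation.Nullary.Decidable using (_⊎-dec_)
open import Relation.Binary.PropositionalEquality using (_≡_)
open import Function.Bundles using (_⇔_)

record Graph (n : ℕ) : Set₁ where
  field
    Adj     : Fin n → Fin n → Set
    symm    : ∀ {x y} → Adj x y → Adj y x
    irrefl  : ∀ {x} → ¬ Adj x x

restrict : ∀ {n} → Fin n → Fin n → List (Fin n) → List (Fin n)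
restrict x y = filter (λ z → (z ≟ x) ⊎-dec (z ≟ y))

countXX : ∀ {n} → Fin n → List (Fin n) → ℕ
countXX x []            = 0
countXX x (a ∷ [])      = 0
countXX x (a ∷ b ∷ rest) =
  (if does (a ≟ x) ∧ does (b ≟ x) then 1 else 0) + countXX x (b ∷ rest)

Is1-11-Rep : ∀ {n} → Graph n → List (Fin n) → Set
Is1-11-Rep {n} G w =
  ¬ (w ≡ []) ×
  (∀ (x y : Fin n) → ¬ (x ≡ y) →
     (Graph.Adj G x y ⇔
       (countXX x (restrict x y w) + countXX y (restrict x y w) ≤ 1)))

IsPermOfV : ∀ {n} → List (Fin n) → Set
IsPermOfV {n} P = P ↭ allFin n

-- Restricted to two distinct letters x and y, every permutation of V becomes the
-- two-letter word ab with {a, b} = {x, y}.  Hence w_{x,y} has the form L (ab)(ab)(ab) R,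
-- and the word with the cube replaced by a single copy of the permutation restricts to
-- L (ab) R.  Since a ≠ b, neither aa nor bb occurs inside (ab)^k or at its junction with
-- a fixed left context, so both words have the same numbers of factors xx and yy.
module Submission where

open import Defs
open import Data.Nat using (ℕ; _+_; _≤_)
open import Data.Fin using (Fin; _≟_)
open import Data.List using (List; []; _∷_; concat; _++_)
open import Data.List.Properties using (filter-++; concat-++; ++-conicalˡ; ++-conicalʳ)
open import Data.List.Relation.Unary.All using (All; _∷_; lookup)
open import Data.List.Relation.Unary.All.Properties using (all-filter)
open import Data.List.Relation.Unary.AllPairs using (_∷_)
open import Data.List.Relation.Unary.Any using (here)
open import Data.List.Relation.Unary.Unique.Propositional using (Unique)
import Data.List.Relation.Unary.Unique.Propositional.Properties as Unique
open import Data.List.Relation.Binary.Permutation.Propositional using (↭-sym; ↭⇒↭ₛ)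
open import Data.List.Relation.Binary.Permutation.Propositional.Properties using (∈-resp-↭)
open import Data.List.Relation.Binary.Permutation.Setoid.Properties using (Unique-resp-↭)
open import Data.List.Membership.Propositional using (_∈_)
open import Data.List.Membership.Propositional.Properties using (∈-filter⁺; ∈-allFin; ∈-++⁺ʳ)
open import Data.Product using (Σ-syntax; _×_; _,_)
open import Data.Sum using (_⊎_; inj₁; inj₂)
open import Data.Empty using (⊥; ⊥-elim)
open import Relation.Nullary using (¬_; yes; no)
open import Relation.Nullary.Decidable using (_⊎-dec_)
import Relation.Unary as U
open import Relation.Binary.PropositionalEquality
  using (_≡_; refl; sym; trans; cong; cong₂; subst; setoid; module ≡-Reasoning)
open import Function.Bundles using (_⇔_)

unique-pair : ∀ {A : Set} {x y : A} → ¬ x ≡ y → (r : List A) →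
              All (λ z → z ≡ x ⊎ z ≡ y) r → Unique r → x ∈ r → y ∈ r →
              Σ[ a ∈ A ] Σ[ b ∈ A ] r ≡ a ∷ b ∷ [] × ¬ a ≡ b
unique-pair x≢y (a ∷ []) _ _ (here refl) (here refl) = ⊥-elim (x≢y refl)
unique-pair x≢y (a ∷ b ∷ []) _ ((a≢b ∷ _) ∷ _) _ _ = a , b , refl , a≢b
unique-pair {x = x} {y} x≢y (a ∷ b ∷ c ∷ _) (a∈ ∷ b∈ ∷ c∈ ∷ _)
            ((a≢b ∷ a≢c ∷ _) ∷ (b≢c ∷ _) ∷ _) _ _ = ⊥-elim (pigeonhole a∈ b∈ c∈)
  where
  pigeonhole : a ≡ x ⊎ a ≡ y → b ≡ x ⊎ b ≡ y → c ≡ x ⊎ c ≡ y → ⊥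
  pigeonhole (inj₁ p) (inj₁ q) _        = a≢b (trans p (sym q))
  pigeonhole (inj₂ p) (inj₂ q) _        = a≢b (trans p (sym q))
  pigeonhole (inj₁ p) _        (inj₁ q) = a≢c (trans p (sym q))
  pigeonhole (inj₂ p) _        (inj₂ q) = a≢c (trans p (sym q))
  pigeonhole _        (inj₁ p) (inj₁ q) = b≢c (trans p (sym q))
  pigeonhole _        (inj₂ p) (inj₂ q) = b≢c (trans p (sym q))

module _ {n : ℕ} where

  IsPermOfV⇒Unique : {P : List (Fin n)} → IsPermOfV P → Unique P
  IsPermOfV⇒Unique P↭V = Unique-resp-↭ (setoid (Fin n)) (↭⇒↭ₛ (↭-sym P↭V)) (Unique.allFin⁺ n)

  restrict-perm : {x y : Fin n} → ¬ x ≡ y → {P : List (Fin n)} → IsPermOfV P →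
                  Σ[ a ∈ Fin n ] Σ[ b ∈ Fin n ] restrict x y P ≡ a ∷ b ∷ [] × ¬ a ≡ b
  restrict-perm {x} {y} x≢y {P} P↭V = unique-pair x≢y (restrict x y P)
    (all-filter x∨y? P)
    (Unique.filter⁺ x∨y? (IsPermOfV⇒Unique P↭V))
    (∈-filter⁺ x∨y? (∈-resp-↭ (↭-sym P↭V) (∈-allFin x)) (inj₁ refl))
    (∈-filter⁺ x∨y? (∈-resp-↭ (↭-sym P↭V) (∈-allFin y)) (inj₂ refl))
    where
    x∨y? : U.Decidable (λ z → z ≡ x ⊎ z ≡ y)
    x∨y? z = (z ≟ x) ⊎-dec (z ≟ y)

  restrict-concat-++ : (x y : Fin n) (Us Ws : List (List (Fin n))) →
    restrict x y (concat (Us ++ Ws)) ≡ restrict x y (concat Us) ++ restrict x y (concat Ws)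
  restrict-concat-++ x y Us Ws =
    trans (cong (restrict x y) (sym (concat-++ Us Ws))) (filter-++ _ (concat Us) (concat Ws))

  restrict-++-pair : {x y a b : Fin n} {P : List (Fin n)} → restrict x y P ≡ a ∷ b ∷ [] →
                     (w : List (Fin n)) → restrict x y (P ++ w) ≡ a ∷ b ∷ restrict x y w
  restrict-++-pair {x} {y} {P = P} eq w = trans (filter-++ _ P w) (cong (_++ restrict x y w) eq)

  countXX-abab : (z : Fin n) {a b : Fin n} → ¬ a ≡ b → (w : List (Fin n)) →
                 countXX z (a ∷ b ∷ a ∷ b ∷ w) ≡ countXX z (a ∷ b ∷ w)
  countXX-abab z {a} {b} a≢b w with a ≟ z | b ≟ z
  ... | yes refl | yes refl = ⊥-elim (a≢b refl)
  ... | yes _    | no _     = refl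
  ... | no _     | yes _    = refl
  ... | no _     | no _     = refl

  countXX-++ˡ : (z c : Fin n) {u v : List (Fin n)} → countXX z (c ∷ u) ≡ countXX z (c ∷ v) →
                (L : List (Fin n)) → countXX z (L ++ c ∷ u) ≡ countXX z (L ++ c ∷ v)
  countXX-++ˡ z c eq []          = eq
  countXX-++ˡ z c eq (d ∷ [])    = cong (_ +_) eq
  countXX-++ˡ z c eq (d ∷ e ∷ L) = cong (_ +_) (countXX-++ˡ z c eq (e ∷ L))

  countXX-cube : (z : Fin n) {a b : Fin n} → ¬ a ≡ b → (L R : List (Fin n)) →
                 countXX z (L ++ a ∷ b ∷ a ∷ b ∷ a ∷ b ∷ R) ≡ countXX z (L ++ a ∷ b ∷ R)
  countXX-cube z {a} {b} a≢b L R =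
    countXX-++ˡ z a (trans (countXX-abab z a≢b (a ∷ b ∷ R)) (countXX-abab z a≢b R)) L

  concat-cube-≡[] : (A B : List (List (Fin n))) (P : List (Fin n)) →
                    concat (A ++ P ∷ B) ≡ [] → concat (A ++ P ∷ P ∷ P ∷ B) ≡ []
  concat-cube-≡[] A B P empty = begin
    concat (A ++ P ∷ P ∷ P ∷ B)         ≡⟨ concat-++ A _ ⟨
    concat A ++ P ++ P ++ P ++ concat B
      ≡⟨ cong₂ _++_ A≡[] (cong₂ _++_ P≡[] (cong₂ _++_ P≡[] (cong₂ _++_ P≡[] B≡[]))) ⟩
    []                                  ∎
    where
    open ≡-Reasoning
    split : concat A ++ P ++ concat B ≡ []
    split = trans (concat-++ A (P ∷ B)) empty
    A≡[] : concat A ≡ []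
    A≡[] = ++-conicalˡ (concat A) _ split
    P≡[] : P ≡ []
    P≡[] = ++-conicalˡ P (concat B) (++-conicalʳ (concat A) _ split)
    B≡[] : concat B ≡ []
    B≡[] = ++-conicalʳ P (concat B) (++-conicalʳ (concat A) _ split)

  countXXYY : Fin n → Fin n → List (Fin n) → ℕ
  countXXYY x y r = countXX x r + countXX y r

  countXXYY-cube : {x y : Fin n} → ¬ x ≡ y → (A B : List (List (Fin n))) {P : List (Fin n)} →
                   IsPermOfV P →
                   countXXYY x y (restrict x y (concat (A ++ P ∷ P ∷ P ∷ B)))
                     ≡ countXXYY x y (restrict x y (concat (A ++ P ∷ B)))
  countXXYY-cube {x} {y} x≢y A B {P} P↭V with restrict-perm x≢y P↭V
  ... | a , b , P↦ab , a≢b = begin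
    countXXYY x y (restrict x y (concat (A ++ P ∷ P ∷ P ∷ B)))  ≡⟨ cong (countXXYY x y) cube↦ ⟩
    countXXYY x y (L ++ a ∷ b ∷ a ∷ b ∷ a ∷ b ∷ R)
      ≡⟨ cong₂ _+_ (countXX-cube x a≢b L R) (countXX-cube y a≢b L R) ⟩
    countXXYY x y (L ++ a ∷ b ∷ R)                             ≡⟨ cong (countXXYY x y) single↦ ⟨
    countXXYY x y (restrict x y (concat (A ++ P ∷ B)))          ∎
    where
    open ≡-Reasoning
    L R : List (Fin n)
    L = restrict x y (concat A)
    R = restrict x y (concat B)
    P++↦ab : (w : List (Fin n)) → restrict x y (P ++ w) ≡ a ∷ b ∷ restrict x y w
    P++↦ab = restrict-++-pair {P = P} P↦ab
    cube↦ : restrict x y (concat (A ++ P ∷ P ∷ P ∷ B)) ≡ L ++ a ∷ b ∷ a ∷ b ∷ a ∷ b ∷ R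
    cube↦ = begin
      restrict x y (concat (A ++ P ∷ P ∷ P ∷ B))      ≡⟨ restrict-concat-++ x y A _ ⟩
      L ++ restrict x y (P ++ P ++ P ++ concat B)     ≡⟨ cong (L ++_) (P++↦ab _) ⟩
      L ++ a ∷ b ∷ restrict x y (P ++ P ++ concat B)  ≡⟨ cong (λ r → L ++ a ∷ b ∷ r) (P++↦ab _) ⟩
      L ++ a ∷ b ∷ a ∷ b ∷ restrict x y (P ++ concat B)
        ≡⟨ cong (λ r → L ++ a ∷ b ∷ a ∷ b ∷ r) (P++↦ab _) ⟩
      L ++ a ∷ b ∷ a ∷ b ∷ a ∷ b ∷ R                  ∎
    single↦ : restrict x y (concat (A ++ P ∷ B)) ≡ L ++ a ∷ b ∷ R
    single↦ = trans (restrict-concat-++ x y A _) (cong (L ++_) (P++↦ab _))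

mainTheorem4 : ∀ {n : ℕ} (G : Graph n) (Ps : List (List (Fin n))) →
    All IsPermOfV Ps →
    Is1-11-Rep G (concat Ps) →
    ∀ (A B : List (List (Fin n))) (P : List (Fin n)) →
    Ps ≡ A ++ (P ∷ P ∷ P ∷ B) →
    Is1-11-Rep G (concat (A ++ (P ∷ B)))
mainTheorem4 G _ perms (nonempty , represents) A B P refl =
  (λ empty → nonempty (concat-cube-≡[] A B P empty)) ,
  λ x y x≢y → subst (λ k → Graph.Adj G x y ⇔ (k ≤ 1))
                    (countXXYY-cube x≢y A B P↭V) (represents x y x≢y)
  where
  P↭V : IsPermOfV P
  P↭V = lookup perms (∈-++⁺ʳ A (here refl))
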